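{- If $\vdash \Gamma,\Theta_\mathbf{J}$ is provable in $\mathsf{MLL}_\mathbf{J}$ with $\Gamma$ nonempty, then $\vdash \Gamma|_\mathbf{J}$ (the erasure of $\mathbf{J}$ in $\Gamma$) is provable in $\mathsf{MLL}$. More precisely, for a proof $\pi$ of $\vdash \Gamma,\Theta_\mathbf{J}$, the erasure $\pi|_\mathbf{J}$ is an $\mathsf{MLL}$ proof, and there is an embedding $\pi|_\mathbf{J} \hookrightarrow \pi$ of the rules of $\pi|_\mathbf{J}$ onto the rules of $\pi$ that preserves their kind and the order between them.
   Context: $\mathsf{MLL}$ formulas are built from atoms, negated atoms, tensor $\otimes$ and par $⅋$. $\mathbf{J}$ is a special atom. $\mathsf{MLL}_\mathbf{J}$ is the cut-free sequent calculus with the $\mathsf{MLL}$ rules plus two rules in which $F$ is not $\mathbf{J}$ or $\mathbf{J}^\perp$ and $\Theta_\mathbf{J}$ is a list of $\mathbf{J}$ or $\mathbf{J}^\perp$ formulas. (i) From $\vdash\Gamma,F,\Theta_\mathbf{J}$ and the axiom $\vdash\mathbf{J},\mathbf{J}^\perp$, derive $\vdash\Gamma,F\otimes\mathbf{J},\mathbf{J}^\perp,\Theta_\mathbf{J}$. (ii) From $\vdash\Gamma,F,\mathbf{J}^\perp,\Theta_\mathbf{J}$, derive $\vdash\Gamma,F⅋\mathbf{J}^\perp,\Theta_\mathbf{J}$. $\mathsf{MLL}_\mathbf{J}$-formulas are given by $F_J ::= A \mid F_J⅋F_J \mid F_J\otimes F_J \mid F_J⅋\mathbf{J}^\perp \mid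 F_J\otimes\mathbf{J}$. The erasure $F|_\mathbf{J}$ of an $\mathsf{MLL}_\mathbf{J}$-formula is defined as follows: $F|_\mathbf{J}=F$ for atoms; for $F=F_0 \Box F_1$ with $\Box\in\{⅋,\otimes\}$, $F|_\mathbf{J}=F_0|_\mathbf{J}$ if $F_1\in\{\mathbf{J},\mathbf{J}^\perp\}$, and $F_0|_\mathbf{J}\Box F_1|_\mathbf{J}$ otherwise. The erasure $\pi|_\mathbf{J}$ of an $\eta$-expanded proof $\pi$ (one with atomic axioms only) keeps axioms, keeps ordinary ⅋ and $\otimes$ rules (acting on the erased formulas), and deletes each rule (ii) as well as each rule (i) together with its $\mathbf{J}$-axiom. In the latter case it is replaced by the erasure of the remaining subproof. -}

module Defs where

open import Data.Nat using (ℕ)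
open import Data.List using (List; []; _∷_; _++_; map)
open import Data.List.Relation.Unary.All using (All)
open import Data.List.Relation.Binary.Permutation.Propositional using (_↭_)
open import Data.Sum using (_⊎_)
open import Relation.Binary.PropositionalEquality using (_≡_)
open import Relation.Nullary using (¬_)

data Atom : Set where
  var : ℕ → Atom
  J   : Atom

data Formula : Set where
  pos : Atom → Formula
  neg : Atom → Formula
  _⊗_ : Formula → Formula → Formula
  _⅋_ : Formula → Formula → Formula

infixr 6 _⊗_ _⅋_

IsJ : Formula → Set
IsJ F = (F ≡ pos J) ⊎ (F ≡ neg J)

data IsFJ : Formula → Set where
  atom⁺ : ∀ n → IsFJ (pos (var n))
  atom⁻ : ∀ n → IsFJ (neg (var n))
  par   : ∀ {F G} → IsFJ F → IsFJ G → IsFJ (F ⅋ G)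
  tens  : ∀ {F G} → IsFJ F → IsFJ G → IsFJ (F ⊗ G)
  parJ  : ∀ {F} → IsFJ F → IsFJ (F ⅋ neg J)
  tensJ : ∀ {F} → IsFJ F → IsFJ (F ⊗ pos J)

erase : Formula → Formula
erase (pos a) = pos a
erase (neg a) = neg a
erase (F ⊗ pos J) = erase F
erase (F ⊗ neg J) = erase F
erase (F ⊗ G) = erase F ⊗ erase G
erase (F ⅋ pos J) = erase F
erase (F ⅋ neg J) = erase F
erase (F ⅋ G) = erase F ⅋ erase G

-- Sequents are lists; exchange is built into every rule
-- (the conclusion may be any permutation of the displayed sequent), so
-- there is no separate exchange rule.  Axioms are atomic (η-expanded proofs).

data MLL⊢ : List Formula → Set where
  ax  : ∀ {Σ} (a : Atom) → Σ ↭ (pos a ∷ neg a ∷ []) → MLL⊢ Σ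
  ⊗-r : ∀ {Σ A B Γ Δ} → MLL⊢ (A ∷ Γ) → MLL⊢ (B ∷ Δ) →
        Σ ↭ ((A ⊗ B) ∷ Γ ++ Δ) → MLL⊢ Σ
  ⅋-r : ∀ {Σ A B Γ} → MLL⊢ (A ∷ B ∷ Γ) →
        Σ ↭ ((A ⅋ B) ∷ Γ) → MLL⊢ Σ

-- The ordinary MLL rules never introduce F ⊗ J or F ⅋ J^⊥
-- and the J-axiom occurs only as the right premise of rule (i); this is the
-- reading under which the erasure of proofs is defined.
data MLLJ⊢ : List Formula → Set where
  ax    : ∀ {Σ} (n : ℕ) → Σ ↭ (pos (var n) ∷ neg (var n) ∷ []) → MLLJ⊢ Σ
  ⊗-r   : ∀ {Σ A B Γ Δ} → ¬ IsJ B → MLLJ⊢ (A ∷ Γ) → MLLJ⊢ (B ∷ Δ) →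
          Σ ↭ ((A ⊗ B) ∷ Γ ++ Δ) → MLLJ⊢ Σ
  ⅋-r   : ∀ {Σ A B Γ} → ¬ IsJ B → MLLJ⊢ (A ∷ B ∷ Γ) →
          Σ ↭ ((A ⅋ B) ∷ Γ) → MLLJ⊢ Σ
  -- rule (i): from ⊢ Γ,F,Θ_J and the axiom ⊢ J,J^⊥ derive ⊢ Γ, F⊗J, J^⊥, Θ_J
  J⊗-r  : ∀ {Σ F Γ Θ} → ¬ IsJ F → All IsJ Θ → MLLJ⊢ (F ∷ Γ ++ Θ) →
          Σ ↭ ((F ⊗ pos J) ∷ neg J ∷ Γ ++ Θ) → MLLJ⊢ Σ
  -- rule (ii): from ⊢ Γ,F,J^⊥,Θ_J derive ⊢ Γ, F⅋J^⊥, Θ_J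
  J⅋-r  : ∀ {Σ F Γ Θ} → ¬ IsJ F → All IsJ Θ → MLLJ⊢ (F ∷ neg J ∷ Γ ++ Θ) →
          Σ ↭ ((F ⅋ neg J) ∷ Γ ++ Θ) → MLLJ⊢ Σ

-- Rule trees (skeletons) of proofs: rule kinds, principal formulas and the
-- tree structure.  The J-axiom of rule (i) is part of the J⊗ node.

data Skel : Set where
  ax   : Atom → Skel
  tens : Formula → Formula → Skel → Skel → Skel
  par  : Formula → Formula → Skel → Skel
  jtens : Formula → Skel → Skel
  jpar  : Formula → Skel → Skel

skel : ∀ {Σ} → MLL⊢ Σ → Skel
skel (ax a _) = ax a
skel (⊗-r {A = A} {B = B} p q _) = tens A B (skel p) (skel q)
skel (⅋-r {A = A} {B = B} p _) = par A B (skel p)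

skelJ : ∀ {Σ} → MLLJ⊢ Σ → Skel
skelJ (ax n _) = ax (var n)
skelJ (⊗-r {A = A} {B = B} _ p q _) = tens A B (skelJ p) (skelJ q)
skelJ (⅋-r {A = A} {B = B} _ p _) = par A B (skelJ p)
skelJ (J⊗-r {F = F} _ _ p _) = jtens F (skelJ p)
skelJ (J⅋-r {F = F} _ _ p _) = jpar F (skelJ p)

eraseSkel : Skel → Skel
eraseSkel (ax a) = ax a
eraseSkel (tens A B s t) = tens (erase A) (erase B) (eraseSkel s) (eraseSkel t)
eraseSkel (par A B s) = par (erase A) (erase B) (eraseSkel s)
eraseSkel (jtens F s) = eraseSkel s
eraseSkel (jpar F s) = eraseSkel s

eraseProof : ∀ {Σ} → MLLJ⊢ Σ → Skel
eraseProof π = eraseSkel (skelJ π)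

data Pos : Skel → Set where
  here   : ∀ {s} → Pos s
  tensˡ  : ∀ {A B s t} → Pos s → Pos (tens A B s t)
  tensʳ  : ∀ {A B s t} → Pos t → Pos (tens A B s t)
  par↑   : ∀ {A B s} → Pos s → Pos (par A B s)
  jtens↑ : ∀ {F s} → Pos s → Pos (jtens F s)
  jpar↑  : ∀ {F s} → Pos s → Pos (jpar F s)

data Kind : Set where
  axK tensK parK jtensK jparK : Kind

kindOf : (s : Skel) → Pos s → Kind
kindOf (ax a) here = axK
kindOf (tens A B s t) here = tensK
kindOf (par A B s) here = parK
kindOf (jtens F s) here = jtensK
kindOf (jpar F s) here = jparK
kindOf (tens A B s t) (tensˡ p) = kindOf s p
kindOf (tens A B s t) (tensʳ p) = kindOf t p
kindOf (par A B s) (par↑ p) = kindOf s p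
kindOf (jtens F s) (jtens↑ p) = kindOf s p
kindOf (jpar F s) (jpar↑ p) = kindOf s p

-- the order between rules: p ⊑ q iff rule p is below (or equal to) rule q,
-- i.e. q lies in the subproof ending with p
data _⊑_ : {s : Skel} → Pos s → Pos s → Set where
  here   : ∀ {s} {q : Pos s} → here ⊑ q
  tensˡ  : ∀ {A B s t} {p q : Pos s} → p ⊑ q → tensˡ {A} {B} {s} {t} p ⊑ tensˡ q
  tensʳ  : ∀ {A B s t} {p q : Pos t} → p ⊑ q → tensʳ {A} {B} {s} {t} p ⊑ tensʳ q
  par↑   : ∀ {A B s} {p q : Pos s} → p ⊑ q → par↑ {A} {B} p ⊑ par↑ q
  jtens↑ : ∀ {F s} {p q : Pos s} → p ⊑ q → jtens↑ {F} p ⊑ jtens↑ q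
  jpar↑  : ∀ {F s} {p q : Pos s} → p ⊑ q → jpar↑ {F} p ⊑ jpar↑ q

-- Erase a sequent by dropping its J and J^⊥ formulas and erasing the others.
-- By induction on π, each ordinary rule becomes the same rule on the erased
-- formulas, while rules (i) and (ii) have premise and conclusion with the same
-- erased sequent, so they can be dropped.
-- The invariant that every formula of the sequent is an MLL_J-formula or J/J^⊥
-- guarantees that the active formulas of an ordinary rule are never J/J^⊥.
-- The embedding sends each rule of π|_J to the rule of π it came from.
module Submission where

open import Defs
open import Data.List using (List; []; _∷_; _++_; map; filter)
open import Data.List.Properties using (map-++; filter-++; filter-accept; filter-reject; filter-all; filter-none; ++-identityʳ)
open import Data.List.Relation.Unary.All as All using (All; _∷_)
open import Data.List.Relation.Unary.All.Properties using (++⁺; ++⁻ˡ; ++⁻ʳ)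
open import Data.List.Relation.Binary.Permutation.Propositional using (_↭_; ↭-reflexive; ↭-trans)
open import Data.List.Relation.Binary.Permutation.Propositional.Properties using (map⁺; filter-↭; All-resp-↭)
open import Data.Product using (Σ; _×_; _,_)
open import Data.Sum using (inj₁; inj₂)
open import Function using (_∘_)
open import Function.Definitions using (Injective)
open import Function.Bundles using (_⇔_; mk⇔)
open import Relation.Nullary using (¬_; yes; no; ¬?; contradiction)
open import Relation.Unary using (Decidable; _∪_)
open import Relation.Binary.PropositionalEquality using (_≡_; _≢_; refl; cong; cong₂; subst; sym; trans; module ≡-Reasoning)
open ≡-Reasoning

¬IsJ-⊗ : ∀ {A B} → ¬ IsJ (A ⊗ B)
¬IsJ-⊗ (inj₁ ())
¬IsJ-⊗ (inj₂ ())

¬IsJ-⅋ : ∀ {A B} → ¬ IsJ (A ⅋ B)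
¬IsJ-⅋ (inj₁ ())
¬IsJ-⅋ (inj₂ ())

isJ? : Decidable IsJ
isJ? (pos (var n)) = no λ { (inj₁ ()) ; (inj₂ ()) }
isJ? (pos J)       = yes (inj₁ refl)
isJ? (neg (var n)) = no λ { (inj₁ ()) ; (inj₂ ()) }
isJ? (neg J)       = yes (inj₂ refl)
isJ? (A ⊗ B)       = no ¬IsJ-⊗
isJ? (A ⅋ B)       = no ¬IsJ-⅋

IsFJ⇒¬IsJ : ∀ {F} → IsFJ F → ¬ IsJ F
IsFJ⇒¬IsJ () (inj₁ refl)
IsFJ⇒¬IsJ () (inj₂ refl)

IsFJ∪IsJ⇒IsFJ : ∀ {F} → ¬ IsJ F → (IsFJ ∪ IsJ) F → IsFJ F
IsFJ∪IsJ⇒IsFJ _   (inj₁ fF) = fF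
IsFJ∪IsJ⇒IsFJ F∉J (inj₂ jF) = contradiction jF F∉J

IsFJ-⊗⁻ : ∀ {A B} → ¬ IsJ B → IsFJ (A ⊗ B) → IsFJ A × IsFJ B
IsFJ-⊗⁻ _   (tens fA fB) = fA , fB
IsFJ-⊗⁻ B∉J (tensJ _)    = contradiction (inj₁ refl) B∉J

IsFJ-⅋⁻ : ∀ {A B} → ¬ IsJ B → IsFJ (A ⅋ B) → IsFJ A × IsFJ B
IsFJ-⅋⁻ _   (par fA fB) = fA , fB
IsFJ-⅋⁻ B∉J (parJ _)    = contradiction (inj₂ refl) B∉J

IsFJ-⊗J⁻ : ∀ {F} → IsFJ (F ⊗ pos J) → IsFJ F
IsFJ-⊗J⁻ (tens _ ())
IsFJ-⊗J⁻ (tensJ fF) = fF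

IsFJ-⅋J⁻ : ∀ {F} → IsFJ (F ⅋ neg J) → IsFJ F
IsFJ-⅋J⁻ (par _ ())
IsFJ-⅋J⁻ (parJ fF) = fF

erase-⊗ : ∀ A {B} → ¬ IsJ B → erase (A ⊗ B) ≡ erase A ⊗ erase B
erase-⊗ A {pos (var n)} _ = refl
erase-⊗ A {pos J}     B∉J = contradiction (inj₁ refl) B∉J
erase-⊗ A {neg (var n)} _ = refl
erase-⊗ A {neg J}     B∉J = contradiction (inj₂ refl) B∉J
erase-⊗ A {_ ⊗ _}       _ = refl
erase-⊗ A {_ ⅋ _}       _ = refl

erase-⅋ : ∀ A {B} → ¬ IsJ B → erase (A ⅋ B) ≡ erase A ⅋ erase B
erase-⅋ A {pos (var n)} _ = refl
erase-⅋ A {pos J}     B∉J = contradiction (inj₁ refl) B∉J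
erase-⅋ A {neg (var n)} _ = refl
erase-⅋ A {neg J}     B∉J = contradiction (inj₂ refl) B∉J
erase-⅋ A {_ ⊗ _}       _ = refl
erase-⅋ A {_ ⅋ _}       _ = refl

eraseSeq : List Formula → List Formula
eraseSeq = map erase ∘ filter (¬? ∘ isJ?)

eraseSeq-∷ : ∀ {F} Φ → ¬ IsJ F → eraseSeq (F ∷ Φ) ≡ erase F ∷ eraseSeq Φ
eraseSeq-∷ _ F∉J = cong (map erase) (filter-accept (¬? ∘ isJ?) F∉J)

eraseSeq-∷J : ∀ {F} Φ → IsJ F → eraseSeq (F ∷ Φ) ≡ eraseSeq Φ
eraseSeq-∷J _ jF = cong (map erase) (filter-reject (¬? ∘ isJ?) (λ F∉J → F∉J jF))

eraseSeq-++ : ∀ Φ Φ′ → eraseSeq (Φ ++ Φ′) ≡ eraseSeq Φ ++ eraseSeq Φ′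
eraseSeq-++ Φ Φ′ = begin
  map erase (filter (¬? ∘ isJ?) (Φ ++ Φ′))
    ≡⟨ cong (map erase) (filter-++ (¬? ∘ isJ?) Φ Φ′) ⟩
  map erase (filter (¬? ∘ isJ?) Φ ++ filter (¬? ∘ isJ?) Φ′)
    ≡⟨ map-++ erase (filter (¬? ∘ isJ?) Φ) _ ⟩
  eraseSeq Φ ++ eraseSeq Φ′ ∎

eraseSeq-↭ : ∀ {Φ Φ′} → Φ ↭ Φ′ → eraseSeq Φ ↭ eraseSeq Φ′
eraseSeq-↭ = map⁺ erase ∘ filter-↭ (¬? ∘ isJ?)

eraseSeq-FJ : ∀ {Γ} → All IsFJ Γ → eraseSeq Γ ≡ map erase Γ
eraseSeq-FJ fΓ = cong (map erase) (filter-all (¬? ∘ isJ?) (All.map IsFJ⇒¬IsJ fΓ))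

eraseSeq-J : ∀ {Θ} → All IsJ Θ → eraseSeq Θ ≡ []
eraseSeq-J jΘ = cong (map erase) (filter-none (¬? ∘ isJ?) (All.map (λ jF F∉J → F∉J jF) jΘ))

SkelProof : Skel → List Formula → Set
SkelProof s Φ = Σ (MLL⊢ Φ) (λ ρ → skel ρ ≡ s)

reorder : ∀ {s Φ Φ′} → Φ′ ↭ Φ → SkelProof s Φ → SkelProof s Φ′
reorder σ (ax a p , e)      = ax a (↭-trans σ p) , e
reorder σ (⊗-r ρ ρ′ p , e) = ⊗-r ρ ρ′ (↭-trans σ p) , e
reorder σ (⅋-r ρ p , e)     = ⅋-r ρ (↭-trans σ p) , e

⊗-rˢ : ∀ {s t Φ A B Γ Δ} → SkelProof s (A ∷ Γ) → SkelProof t (B ∷ Δ) →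
       Φ ↭ ((A ⊗ B) ∷ Γ ++ Δ) → SkelProof (tens A B s t) Φ
⊗-rˢ (ρ , refl) (ρ′ , refl) p = ⊗-r ρ ρ′ p , refl

⅋-rˢ : ∀ {s Φ A B Γ} → SkelProof s (A ∷ B ∷ Γ) →
       Φ ↭ ((A ⅋ B) ∷ Γ) → SkelProof (par A B s) Φ
⅋-rˢ (ρ , refl) p = ⅋-r ρ p , refl

erasure : ∀ {Φ} (π : MLLJ⊢ Φ) → All (IsFJ ∪ IsJ) Φ → SkelProof (eraseProof π) (eraseSeq Φ)
erasure (ax n p) _ = ax (var n) (eraseSeq-↭ p) , refl
erasure (⊗-r {A = A} {B} {Γ} {Δ} B∉J π π′ p) wf
  with wfA⊗B ∷ wfΓΔ ← All-resp-↭ p wf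
  with fA , fB ← IsFJ-⊗⁻ B∉J (IsFJ∪IsJ⇒IsFJ ¬IsJ-⊗ wfA⊗B) =
  ⊗-rˢ (subst (SkelProof _) (eraseSeq-∷ Γ (IsFJ⇒¬IsJ fA)) (erasure π (inj₁ fA ∷ ++⁻ˡ Γ wfΓΔ)))
       (subst (SkelProof _) (eraseSeq-∷ Δ B∉J) (erasure π′ (inj₁ fB ∷ ++⁻ʳ Γ wfΓΔ)))
       (↭-trans (eraseSeq-↭ p) (↭-reflexive (begin
         eraseSeq ((A ⊗ B) ∷ Γ ++ Δ)          ≡⟨ eraseSeq-∷ (Γ ++ Δ) (¬IsJ-⊗ {A} {B}) ⟩
         erase (A ⊗ B) ∷ eraseSeq (Γ ++ Δ)    ≡⟨ cong₂ _∷_ (erase-⊗ A B∉J) (eraseSeq-++ Γ Δ) ⟩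
         (erase A ⊗ erase B) ∷ eraseSeq Γ ++ eraseSeq Δ ∎)))
erasure (⅋-r {A = A} {B} {Γ} B∉J π p) wf
  with wfA⅋B ∷ wfΓ ← All-resp-↭ p wf
  with fA , fB ← IsFJ-⅋⁻ B∉J (IsFJ∪IsJ⇒IsFJ ¬IsJ-⅋ wfA⅋B) =
  ⅋-rˢ (subst (SkelProof _) (trans (eraseSeq-∷ (B ∷ Γ) (IsFJ⇒¬IsJ fA)) (cong (erase A ∷_) (eraseSeq-∷ Γ B∉J)))
         (erasure π (inj₁ fA ∷ inj₁ fB ∷ wfΓ)))
       (↭-trans (eraseSeq-↭ p) (↭-reflexive (begin
         eraseSeq ((A ⅋ B) ∷ Γ)        ≡⟨ eraseSeq-∷ Γ (¬IsJ-⅋ {A} {B}) ⟩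
         erase (A ⅋ B) ∷ eraseSeq Γ    ≡⟨ cong (_∷ eraseSeq Γ) (erase-⅋ A B∉J) ⟩
         (erase A ⅋ erase B) ∷ eraseSeq Γ ∎)))
erasure (J⊗-r {Γ = Γ} {Θ} F∉J _ π p) wf
  with wfF⊗J ∷ _ ∷ wfΓΘ ← All-resp-↭ p wf =
  reorder (↭-trans (eraseSeq-↭ p) (↭-reflexive (sym (eraseSeq-∷ (Γ ++ Θ) F∉J))))
          (erasure π (inj₁ (IsFJ-⊗J⁻ (IsFJ∪IsJ⇒IsFJ ¬IsJ-⊗ wfF⊗J)) ∷ wfΓΘ))
erasure (J⅋-r {Γ = Γ} {Θ} F∉J _ π p) wf
  with wfF⅋J ∷ wfΓΘ ← All-resp-↭ p wf =
  reorder (↭-trans (eraseSeq-↭ p) (↭-reflexive (sym (trans (eraseSeq-∷ (neg J ∷ Γ ++ Θ) F∉J)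
                                                         (cong (_ ∷_) (eraseSeq-∷J (Γ ++ Θ) (inj₂ refl)))))))
          (erasure π (inj₁ (IsFJ-⅋J⁻ (IsFJ∪IsJ⇒IsFJ ¬IsJ-⅋ wfF⅋J)) ∷ inj₂ (inj₂ refl) ∷ wfΓΘ))

⊑-refl : ∀ {s} (p : Pos s) → p ⊑ p
⊑-refl here       = here
⊑-refl (tensˡ p)  = tensˡ (⊑-refl p)
⊑-refl (tensʳ p)  = tensʳ (⊑-refl p)
⊑-refl (par↑ p)   = par↑ (⊑-refl p)
⊑-refl (jtens↑ p) = jtens↑ (⊑-refl p)
⊑-refl (jpar↑ p)  = jpar↑ (⊑-refl p)

⊑-antisym : ∀ {s} {p q : Pos s} → p ⊑ q → q ⊑ p → p ≡ q
⊑-antisym here       here        = refl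
⊑-antisym (tensˡ o)  (tensˡ o′)  = cong tensˡ (⊑-antisym o o′)
⊑-antisym (tensʳ o)  (tensʳ o′)  = cong tensʳ (⊑-antisym o o′)
⊑-antisym (par↑ o)   (par↑ o′)   = cong par↑ (⊑-antisym o o′)
⊑-antisym (jtens↑ o) (jtens↑ o′) = cong jtens↑ (⊑-antisym o o′)
⊑-antisym (jpar↑ o)  (jpar↑ o′)  = cong jpar↑ (⊑-antisym o o′)

embed : (s : Skel) → Pos (eraseSkel s) → Pos s
embed (ax a)         here      = here
embed (tens A B s t) here      = here
embed (tens A B s t) (tensˡ p) = tensˡ (embed s p)
embed (tens A B s t) (tensʳ p) = tensʳ (embed t p)
embed (par A B s)    here      = here
embed (par A B s)    (par↑ p)  = par↑ (embed s p)
embed (jtens F s)    p         = jtens↑ (embed s p)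
embed (jpar F s)     p         = jpar↑ (embed s p)

kindOf-embed : (s : Skel) → ∀ p → kindOf s (embed s p) ≡ kindOf (eraseSkel s) p
kindOf-embed (ax a)         here      = refl
kindOf-embed (tens A B s t) here      = refl
kindOf-embed (tens A B s t) (tensˡ p) = kindOf-embed s p
kindOf-embed (tens A B s t) (tensʳ p) = kindOf-embed t p
kindOf-embed (par A B s)    here      = refl
kindOf-embed (par A B s)    (par↑ p)  = kindOf-embed s p
kindOf-embed (jtens F s)    p         = kindOf-embed s p
kindOf-embed (jpar F s)     p         = kindOf-embed s p

embed-mono : (s : Skel) → ∀ {p q} → p ⊑ q → embed s p ⊑ embed s q
embed-mono (ax a)         here      = here
embed-mono (tens A B s t) here      = here
embed-mono (tens A B s t) (tensˡ o) = tensˡ (embed-mono s o)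
embed-mono (tens A B s t) (tensʳ o) = tensʳ (embed-mono t o)
embed-mono (par A B s)    here      = here
embed-mono (par A B s)    (par↑ o)  = par↑ (embed-mono s o)
embed-mono (jtens F s)    o         = jtens↑ (embed-mono s o)
embed-mono (jpar F s)     o         = jpar↑ (embed-mono s o)

embed-reflects : (s : Skel) → ∀ p q → embed s p ⊑ embed s q → p ⊑ q
embed-reflects (ax a)         here      _         _         = here
embed-reflects (tens A B s t) here      _         _         = here
embed-reflects (tens A B s t) (tensˡ p) (tensˡ q) (tensˡ o) = tensˡ (embed-reflects s p q o)
embed-reflects (tens A B s t) (tensʳ p) (tensʳ q) (tensʳ o) = tensʳ (embed-reflects t p q o)
embed-reflects (par A B s)    here      _         _         = here
embed-reflects (par A B s)    (par↑ p)  (par↑ q)  (par↑ o)  = par↑ (embed-reflects s p q o)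
embed-reflects (jtens F s)    p         q         (jtens↑ o) = embed-reflects s p q o
embed-reflects (jpar F s)     p         q         (jpar↑ o)  = embed-reflects s p q o

embed-injective : (s : Skel) → Injective _≡_ _≡_ (embed s)
embed-injective s {p} {q} e =
  ⊑-antisym (embed-reflects s p q (subst (embed s p ⊑_) e (⊑-refl _)))
            (embed-reflects s q p (subst (_⊑ embed s p) e (⊑-refl _)))

proposition3p4 : (Γ Θ : List Formula) → Γ ≢ [] → All IsFJ Γ → All IsJ Θ →
    (π : MLLJ⊢ (Γ ++ Θ)) →
    Σ (MLL⊢ (map erase Γ)) (λ ρ → skel ρ ≡ eraseProof π)
    × Σ (Pos (eraseProof π) → Pos (skelJ π)) (λ f →
        Injective _≡_ _≡_ f
        × (∀ p → kindOf (skelJ π) (f p) ≡ kindOf (eraseProof π) p)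
        × (∀ p q → (p ⊑ q) ⇔ (f p ⊑ f q)))
proposition3p4 Γ Θ _ fΓ jΘ π =
  subst (SkelProof (eraseProof π)) eraseSeq-Γ++Θ
        (erasure π (++⁺ (All.map inj₁ fΓ) (All.map inj₂ jΘ)))
  , embed s , embed-injective s , kindOf-embed s
  , λ p q → mk⇔ (embed-mono s) (embed-reflects s p q)
  where
  s : Skel
  s = skelJ π
  eraseSeq-Γ++Θ : eraseSeq (Γ ++ Θ) ≡ map erase Γ
  eraseSeq-Γ++Θ = begin
    eraseSeq (Γ ++ Θ)          ≡⟨ eraseSeq-++ Γ Θ ⟩
    eraseSeq Γ ++ eraseSeq Θ   ≡⟨ cong₂ _++_ (eraseSeq-FJ fΓ) (eraseSeq-J jΘ) ⟩
    map erase Γ ++ []          ≡⟨ ++-identityʳ (map erase Γ) ⟩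
    map erase Γ ∎
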